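{- Let $G$ be a $P_5$-free graph, let $(X,Z)$ be a cradle in $G$ and let $(\mathcal{I},\mathcal{J})$ be a rocker for $(X,Z)$. Then $|\mathcal{I}|\leq\omega(G)$ and $|\mathcal{J}|\leq \omega(G)$.
   Context: All graphs are finite and simple; $G$ is $P_5$-free if no induced subgraph is isomorphic to the five-vertex path; $\omega(G)$ is the clique number. For $X\subseteq V(G)$, $N(X)$ is the set of vertices of $V(G)\setminus X$ with a neighbour in $X$, $N[X]=N(X)\cup X$, and $N_Z(X)=N(X)\cap Z$. A cradle in $G$ is a pair $(X,Z)$ of disjoint subsets of $V(G)$ such that either $|X|\leq 1$, or both: every vertex in $N_Z(X)$ has a neighbour in $V(G)\setminus N[X]$; and for every two vertices $z,z'\in N_Z(X)$ there is an induced path in $G$ from $z$ to $z'$ whose interior vertices lie in $V(G)\setminus N[X]$. A vertex is complete (anticomplete) to a set if it is adjacent to all (none) of its vertices. A rocker for a cradle $(X,Z)$ is a pair $(\mathcal{I},\mathcal{J})$ of collections of connected components of $G[X]$ such that: $\mathcal{I}$ has the property that for every $z\in Z$ which is anticomplete to some component of $G[X]$ there is $D\in\mathcal{I}$ with $z$ anticomplete to $D$, and $\mathcal{I}$ is inclusion-minimal with this property; and $\mathcal{J}$ is the collection of all components $D$ of $G[X]$ for which there exists $z\in Z$ having a neighbour in every component of $G[X]$ and a non-neighbour in $D$. -}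

module Defs where

open import Data.Nat using (ℕ; suc; _≤_)
open import Data.Bool using (Bool; true; false)
open import Data.Fin using (Fin; toℕ)
open import Data.Fin.Subset using (Subset; _∈_; _∉_; _⊆_; ∣_∣)
open import Data.List using (List; []; _∷_; _++_; length; lookup)
open import Data.List.Relation.Unary.All using (All)
open import Data.List.Relation.Unary.Unique.Propositional using (Unique)
import Data.List.Membership.Propositional as LM
open import Data.Product using (Σ; ∃; _×_; _,_)
open import Data.Sum using (_⊎_)
open import Relation.Binary.PropositionalEquality using (_≡_)
open import Relation.Nullary using (¬_)
open import Function.Bundles using (_⇔_)

record Graph (n : ℕ) : Set where
  field
    adj    : Fin n → Fin n → Bool
    sym    : ∀ u v → adj u v ≡ adj v u
    irrefl : ∀ u → adj u u ≡ false

module _ {n : ℕ} (G : Graph n) where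
  open Graph G

  Adj : Fin n → Fin n → Set
  Adj u v = adj u v ≡ true

  IsInducedPath : List (Fin n) → Set
  IsInducedPath ps =
    Unique ps ×
    (∀ (i j : Fin (length ps)) →
       Adj (lookup ps i) (lookup ps j) ⇔ (toℕ j ≡ suc (toℕ i) ⊎ toℕ i ≡ suc (toℕ j)))

  P5Free : Set
  P5Free = ∀ (ps : List (Fin n)) → length ps ≡ 5 → ¬ IsInducedPath ps

  IsClique : Subset n → Set
  IsClique S = ∀ u v → u ∈ S → v ∈ S → ¬ (u ≡ v) → Adj u v

  IsCliqueNumber : ℕ → Set
  IsCliqueNumber ω =
    (Σ (Subset n) λ S → IsClique S × ∣ S ∣ ≡ ω) ×
    (∀ S → IsClique S → ∣ S ∣ ≤ ω)

  InN : Subset n → Fin n → Set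
  InN X v = v ∉ X × (∃ λ u → u ∈ X × Adj u v)

  InNClosed : Subset n → Fin n → Set
  InNClosed X v = v ∈ X ⊎ InN X v

  Disjoint : Subset n → Subset n → Set
  Disjoint X Z = ∀ v → v ∈ X → v ∉ Z

  IsCradle : Subset n → Subset n → Set
  IsCradle X Z =
    Disjoint X Z ×
    (∣ X ∣ ≤ 1 ⊎
      ((∀ z → z ∈ Z → InN X z → ∃ λ w → ¬ InNClosed X w × Adj z w) ×
       (∀ z z' → z ∈ Z → InN X z → z' ∈ Z → InN X z' →
          z ≡ z' ⊎
          (∃ λ (ms : List (Fin n)) →
             IsInducedPath (z ∷ ms ++ z' ∷ []) × All (λ m → ¬ InNClosed X m) ms))))

  data WalkIn (D : Subset n) : Fin n → Fin n → Set where
    here : ∀ {u} → u ∈ D → WalkIn D u u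
    step : ∀ {u w v} → u ∈ D → Adj u w → WalkIn D w v → WalkIn D u v

  IsComponent : Subset n → Subset n → Set
  IsComponent X D =
    D ⊆ X ×
    (∃ λ v → v ∈ D) ×
    (∀ u v → u ∈ D → v ∈ D → WalkIn D u v) ×
    (∀ u w → u ∈ D → w ∈ X → Adj u w → w ∈ D)

  Anticomplete : Fin n → Subset n → Set
  Anticomplete z D = ∀ d → d ∈ D → ¬ Adj z d

  HasNbrIn : Fin n → Subset n → Set
  HasNbrIn z D = ∃ λ d → d ∈ D × Adj z d

  HasNonNbrIn : Fin n → Subset n → Set
  HasNonNbrIn z D = ∃ λ d → d ∈ D × ¬ Adj z d

  IsComponentCollection : Subset n → List (Subset n) → Set
  IsComponentCollection X 𝓘 = Unique 𝓘 × All (IsComponent X) 𝓘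

  CoversAnticomplete : Subset n → Subset n → List (Subset n) → Set
  CoversAnticomplete X Z 𝓘 =
    ∀ z → z ∈ Z →
      (∃ λ D → IsComponent X D × Anticomplete z D) →
      ∃ λ D → D LM.∈ 𝓘 × Anticomplete z D

  IsRocker : Subset n → Subset n → List (Subset n) → List (Subset n) → Set
  IsRocker X Z 𝓘 𝓙 =
    IsComponentCollection X 𝓘 ×
    CoversAnticomplete X Z 𝓘 ×
    -- inclusion-minimality: no sub-collection with the property is proper
    (∀ 𝓘' → IsComponentCollection X 𝓘' →
       (∀ D → D LM.∈ 𝓘' → D LM.∈ 𝓘) →
       CoversAnticomplete X Z 𝓘' →
       ∀ D → D LM.∈ 𝓘 → D LM.∈ 𝓘') ×
    IsComponentCollection X 𝓙 ×
    (∀ D → D LM.∈ 𝓙 ⇔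
       (IsComponent X D ×
        (∃ λ z → z ∈ Z ×
           (∀ D' → IsComponent X D' → HasNbrIn z D') ×
           HasNonNbrIn z D)))

{-# OPTIONS --safe #-}
module Submission where

-- Both bounds are witnessed by cliques: to each member D of 𝓘 (resp. 𝓙) we attach a vertex
-- z_D ∈ Z so that distinct members get adjacent vertices.  For 𝓘, minimality gives a z_D
-- anticomplete to D with a neighbour in every other member of 𝓘.  For 𝓙, z_D is the vertex from
-- the definition of 𝓙; it has non-neighbours in no other component, for otherwise edges a₁b₁ of D
-- and a₂b₂ of the other component with z_D ~ bᵢ, z_D ≁ aᵢ give the induced P5 a₁ b₁ z_D b₂ a₂.
-- In both cases distinct D, D′ contain a, a′ with z_D ~ a′, z_D ≁ a, z_D′ ~ a, z_D′ ≁ a′.  If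
-- z_D ≁ z_D′, the cradle provides an induced path z_D … z_D′ with interior outside N[X], and a′
-- followed by the first four vertices of z_D … z_D′ a is an induced P5.

open import Defs
open import Data.Bool using (true; if_then_else_)
import Data.Bool.Properties as Bool
open import Data.Empty using (⊥-elim)
open import Data.Fin using (Fin; zero; suc; toℕ)
open import Data.Fin.Patterns using (0F; 1F; 2F; 3F; 4F)
open import Data.Fin.Properties using (any?)
open import Data.Fin.Subset using (Subset; _∈_; _∉_; _⊆_; ∣_∣; ⁅_⁆; _∪_; ⋃; inside; outside)
open import Data.Fin.Subset.Properties
  using (_∈?_; ⊆-antisym; x∈p∪q⁻; x∈⁅y⁆⇒x≡y; ∉⊥; ∣⊥∣≡0; ∪-identityˡ; p⊆q⇒∣p∣≤∣q∣)
open import Data.List using (List; []; _∷_; length; lookup; map; filter)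
open import Data.List.Relation.Unary.All as All using (All; []; _∷_)
import Data.List.Relation.Unary.All.Properties as All
open import Data.List.Relation.Unary.AllPairs as AllPairs using (AllPairs; []; _∷_)
open import Data.List.Relation.Unary.Any using (here; there)
import Data.List.Membership.Propositional as LM
open import Data.List.Membership.Propositional.Properties using (∈-filter⁺; ∈-filter⁻)
open import Data.List.Relation.Unary.Unique.Propositional using (Unique)
import Data.List.Relation.Unary.Unique.Propositional.Properties as Unique
open import Data.Nat as ℕ using (ℕ; suc; _≤_)
open import Data.Nat.Properties using (<⇒≱)
open import Data.Product using (∃; ∃₂; _×_; _,_; proj₁; proj₂)
open import Data.Sum using (_⊎_; inj₁; inj₂)
open import Data.Vec using (_∷_)
import Data.Vec.Base as Vec
open import Data.Vec.Properties using (≡-dec)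
open import Function using (_∘_)
open import Function.Bundles using (_⇔_; mk⇔; Equivalence)
open import Relation.Binary using (Symmetric)
open import Relation.Binary.PropositionalEquality
  using (_≡_; _≢_; ≢-sym; refl; sym; trans; cong; subst)
open import Relation.Nullary using (¬_; Dec; does; proof; yes; no; contradiction; _×-dec_; ¬?)
open import Relation.Nullary.Decidable using (True; False; toWitness; toWitnessFalse; map′; _⊎-dec_)
open import Relation.Nullary.Reflects using (Reflects; ofʸ; ofⁿ; of)

fromList : ∀ {n} → List (Fin n) → Subset n
fromList = ⋃ ∘ map ⁅_⁆

∈-fromList⁻ : ∀ {n} {v : Fin n} xs → v ∈ fromList xs → v LM.∈ xs
∈-fromList⁻ []       v∈ = contradiction v∈ ∉⊥
∈-fromList⁻ (x ∷ xs) v∈ with x∈p∪q⁻ ⁅ x ⁆ (fromList xs) v∈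
... | inj₁ v∈⁅x⁆ = here (x∈⁅y⁆⇒x≡y x v∈⁅x⁆)
... | inj₂ v∈xs  = there (∈-fromList⁻ xs v∈xs)

∣⁅x⁆∪p∣≡1+∣p∣ : ∀ {n} (x : Fin n) (p : Subset n) → x ∉ p → ∣ ⁅ x ⁆ ∪ p ∣ ≡ suc ∣ p ∣
∣⁅x⁆∪p∣≡1+∣p∣ zero    (inside  ∷ p) x∉p = contradiction Vec.here x∉p
∣⁅x⁆∪p∣≡1+∣p∣ zero    (outside ∷ p) x∉p = cong (suc ∘ ∣_∣) (∪-identityˡ p)
∣⁅x⁆∪p∣≡1+∣p∣ (suc x) (inside  ∷ p) x∉p = cong suc (∣⁅x⁆∪p∣≡1+∣p∣ x p (x∉p ∘ Vec.there))
∣⁅x⁆∪p∣≡1+∣p∣ (suc x) (outside ∷ p) x∉p = ∣⁅x⁆∪p∣≡1+∣p∣ x p (x∉p ∘ Vec.there)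

∣fromList∣≡length : ∀ {n} {xs : List (Fin n)} → Unique xs → ∣ fromList xs ∣ ≡ length xs
∣fromList∣≡length {n} {[]}     []              = ∣⊥∣≡0 n
∣fromList∣≡length {xs = x ∷ xs} (x∉xs ∷ unique) =
  trans (∣⁅x⁆∪p∣≡1+∣p∣ x (fromList xs) (λ x∈ → All.lookup x∉xs (∈-fromList⁻ xs x∈) refl))
        (cong suc (∣fromList∣≡length unique))

two-members⇒2≤∣p∣ : ∀ {n} {a b : Fin n} {p : Subset n} → a ≢ b → a ∈ p → b ∈ p → 2 ≤ ∣ p ∣
two-members⇒2≤∣p∣ {a = a} {b} {p} a≢b a∈p b∈p =
  subst (_≤ ∣ p ∣) (∣fromList∣≡length ((a≢b ∷ []) ∷ [] ∷ [])) (p⊆q⇒∣p∣≤∣q∣ ab⊆p)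
  where
  ab⊆p : fromList (a ∷ b ∷ []) ⊆ p
  ab⊆p v∈ with ∈-fromList⁻ (a ∷ b ∷ []) v∈
  ... | here refl         = a∈p
  ... | there (here refl) = b∈p

allPairs-lookup : ∀ {A : Set} {R : A → A → Set} → Symmetric R →
                  ∀ {xs u v} → AllPairs R xs → u LM.∈ xs → v LM.∈ xs → u ≢ v → R u v
allPairs-lookup R-sym (_    ∷ _)  (here refl) (here refl) u≢v = contradiction refl u≢v
allPairs-lookup R-sym (x~xs ∷ _)  (here refl) (there v∈)  _   = All.lookup x~xs v∈
allPairs-lookup R-sym (x~xs ∷ _)  (there u∈)  (here refl) _   = R-sym (All.lookup x~xs u∈)
allPairs-lookup R-sym (_    ∷ xs) (there u∈)  (there v∈)  u≢v = allPairs-lookup R-sym xs u∈ v∈ u≢v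

Consecutive : ℕ → ℕ → Set
Consecutive i j = j ≡ suc i ⊎ i ≡ suc j

consecutive? : ∀ i j → Dec (Consecutive i j)
consecutive? i j = (j ℕ.≟ suc i) ⊎-dec (i ℕ.≟ suc j)

reflects-same⇒⇔ : ∀ {b} {A C : Set} → Reflects A b → Reflects C b → A ⇔ C
reflects-same⇒⇔ (ofʸ a)  (ofʸ c)  = mk⇔ (λ _ → c) (λ _ → a)
reflects-same⇒⇔ (ofⁿ ¬a) (ofⁿ ¬c) = mk⇔ (⊥-elim ∘ ¬a) (⊥-elim ∘ ¬c)

module _ {n : ℕ} (G : Graph n) where

  Adj-sym : Symmetric (Adj G)
  Adj-sym {u} {v} uv = trans (Graph.sym G v u) uv

  Adj-irrefl : ∀ {u} → ¬ Adj G u u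
  Adj-irrefl {u} uu with trans (sym uu) (Graph.irrefl G u)
  ... | ()

  Adj⇒≢ : ∀ {u v} → Adj G u v → u ≢ v
  Adj⇒≢ uv refl = Adj-irrefl uv

  ≁-sym : ∀ {u v} → ¬ Adj G u v → ¬ Adj G v u
  ≁-sym u≁v = u≁v ∘ Adj-sym

  unshared-neighbour⇒≢ : ∀ {a b c} → Adj G a c → ¬ Adj G b c → a ≢ b
  unshared-neighbour⇒≢ ac b≁c refl = b≁c ac

  adj? : ∀ u v → Dec (Adj G u v)
  adj? u v = Graph.adj G u v Bool.≟ true

  hasNbrIn? : ∀ z D → Dec (HasNbrIn G z D)
  hasNbrIn? z D = any? (λ d → (d ∈? D) ×-dec adj? z d)

  ¬HasNbrIn⇒Anticomplete : ∀ {z D} → ¬ HasNbrIn G z D → Anticomplete G z D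
  ¬HasNbrIn⇒Anticomplete ¬nbr d d∈D zd = ¬nbr (d , d∈D , zd)

  anticomplete? : ∀ z D → Dec (Anticomplete G z D)
  anticomplete? z D =
    map′ ¬HasNbrIn⇒Anticomplete (λ anti (d , d∈D , zd) → anti d d∈D zd) (¬? (hasNbrIn? z D))

  module _ {ω : ℕ} (clique-number : IsCliqueNumber G ω) where

    pairwise-adjacent⇒length≤ω : ∀ {xs} → AllPairs (Adj G) xs → length xs ≤ ω
    pairwise-adjacent⇒length≤ω {xs} adjacent =
      subst (_≤ ω) (∣fromList∣≡length (AllPairs.map Adj⇒≢ adjacent))
            (proj₂ clique-number (fromList xs) clique)
      where
      clique : IsClique G (fromList xs)
      clique u v u∈ v∈ =
        allPairs-lookup Adj-sym adjacent (∈-fromList⁻ xs u∈) (∈-fromList⁻ xs v∈)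

    adjacent-representatives⇒length≤ω :
      ∀ {A : Set} {P : A → Set} (vertex : ∀ {D} → P D → Fin n) →
      (∀ {D D'} (p : P D) (p' : P D') → D ≢ D' → Adj G (vertex p) (vertex p')) →
      ∀ {L} → Unique L → All P L → length L ≤ ω
    adjacent-representatives⇒length≤ω {P = P} vertex adjacent unique ps =
      subst (_≤ ω) (length-reduce ps) (pairwise-adjacent⇒length≤ω (reduce-adjacent unique ps))
      where
      length-reduce : ∀ {L} (ps : All P L) → length (All.reduce vertex ps) ≡ length L
      length-reduce []       = refl
      length-reduce (_ ∷ ps) = cong suc (length-reduce ps)

      adjacent-to-head : ∀ {D L} (p : P D) → All (D ≢_) L → (ps : All P L) →
                         All (Adj G (vertex p)) (All.reduce vertex ps)
      adjacent-to-head p []            []        = []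
      adjacent-to-head p (D≢D' ∷ D≢L) (p' ∷ ps) = adjacent p p' D≢D' ∷ adjacent-to-head p D≢L ps

      reduce-adjacent : ∀ {L} → Unique L → (ps : All P L) → AllPairs (Adj G) (All.reduce vertex ps)
      reduce-adjacent []               []       = []
      reduce-adjacent (D≢L ∷ unique) (p ∷ ps) =
        adjacent-to-head p D≢L ps ∷ reduce-adjacent unique ps

  walk-start : ∀ {D u v} → WalkIn G D u v → u ∈ D
  walk-start (here u∈D)     = u∈D
  walk-start (step u∈D _ _) = u∈D

  walk-enters-neighbourhood : ∀ {D u v} z → WalkIn G D u v → ¬ Adj G z u → Adj G z v →
    ∃₂ λ a b → a ∈ D × b ∈ D × Adj G a b × ¬ Adj G z a × Adj G z b
  walk-enters-neighbourhood z (here _) z≁u zu = contradiction zu z≁u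
  walk-enters-neighbourhood {u = u} z (step {w = w} u∈D uw walk) z≁u zv with adj? z w
  ... | yes zw  = u , w , u∈D , walk-start walk , uw , z≁u , zw
  ... | no z≁w = walk-enters-neighbourhood z walk z≁w zv

  walk-stays-in-closed : ∀ {X D D' u v} → D ⊆ X →
    (∀ u w → u ∈ D' → w ∈ X → Adj G u w → w ∈ D') → WalkIn G D u v → u ∈ D' → v ∈ D'
  walk-stays-in-closed D⊆X closed (here _)                 u∈D' = u∈D'
  walk-stays-in-closed D⊆X closed (step {u} {w} _ uw walk) u∈D' =
    walk-stays-in-closed D⊆X closed walk (closed u w u∈D' (D⊆X (walk-start walk)) uw)

  components-meet⇒≡ : ∀ {X D D' x} → IsComponent G X D → IsComponent G X D' →
    x ∈ D → x ∈ D' → D ≡ D'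
  components-meet⇒≡ {x = x} (D⊆X , _ , walks , closed) (D'⊆X , _ , walks' , closed') x∈D x∈D' =
    ⊆-antisym (λ {v} v∈D → walk-stays-in-closed D⊆X closed' (walks x v x∈D v∈D) x∈D')
              (λ {v} v∈D' → walk-stays-in-closed D'⊆X closed (walks' x v x∈D' v∈D') x∈D)

  distinct-components-anticomplete : ∀ {X D D' u w} → IsComponent G X D → IsComponent G X D' →
    D ≢ D' → u ∈ D → w ∈ D' → ¬ Adj G u w
  distinct-components-anticomplete {u = u} {w} D-comp@(_ , _ , _ , closed) D'-comp@(D'⊆X , _)
                                   D≢D' u∈D w∈D' uw =
    D≢D' (components-meet⇒≡ D-comp D'-comp (closed u w u∈D (D'⊆X w∈D') uw) w∈D')

  adjacent-on-path : ∀ {ps} → IsInducedPath G ps → ∀ i j →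
    {True (consecutive? (toℕ i) (toℕ j))} → Adj G (lookup ps i) (lookup ps j)
  adjacent-on-path (_ , adj⇔) i j {c} = Equivalence.from (adj⇔ i j) (toWitness c)

  nonadjacent-on-path : ∀ {ps} → IsInducedPath G ps → ∀ i j →
    {False (consecutive? (toℕ i) (toℕ j))} → ¬ Adj G (lookup ps i) (lookup ps j)
  nonadjacent-on-path (_ , adj⇔) i j {c} = toWitnessFalse c ∘ Equivalence.to (adj⇔ i j)

  induced-P5 : ∀ p₀ p₁ p₂ p₃ p₄ →
    Adj G p₀ p₁ → Adj G p₁ p₂ → Adj G p₂ p₃ → Adj G p₃ p₄ →
    ¬ Adj G p₀ p₂ → ¬ Adj G p₀ p₃ → ¬ Adj G p₀ p₄ → ¬ Adj G p₁ p₃ → ¬ Adj G p₁ p₄ → ¬ Adj G p₂ p₄ →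
    IsInducedPath G (p₀ ∷ p₁ ∷ p₂ ∷ p₃ ∷ p₄ ∷ [])
  induced-P5 p₀ p₁ p₂ p₃ p₄ e₀₁ e₁₂ e₂₃ e₃₄ n₀₂ n₀₃ n₀₄ n₁₃ n₁₄ n₂₄ =
    distinct , λ i j → reflects-same⇒⇔ (of (edge i j)) (proof (consecutive? (toℕ i) (toℕ j)))
    where
    ps : List (Fin n)
    ps = p₀ ∷ p₁ ∷ p₂ ∷ p₃ ∷ p₄ ∷ []

    distinct : Unique ps
    distinct = ( Adj⇒≢ e₀₁
               ∷ ≢-sym (unshared-neighbour⇒≢ e₂₃ n₀₃)
               ∷ unshared-neighbour⇒≢ e₀₁ (≁-sym n₁₃)
               ∷ unshared-neighbour⇒≢ e₀₁ (≁-sym n₁₄) ∷ [])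
             ∷ ( Adj⇒≢ e₁₂
               ∷ unshared-neighbour⇒≢ (Adj-sym e₀₁) (≁-sym n₀₃)
               ∷ unshared-neighbour⇒≢ (Adj-sym e₀₁) (≁-sym n₀₄) ∷ [])
             ∷ (Adj⇒≢ e₂₃ ∷ unshared-neighbour⇒≢ (Adj-sym e₁₂) (≁-sym n₁₄) ∷ [])
             ∷ (Adj⇒≢ e₃₄ ∷ [])
             ∷ [] ∷ []

    Edge : Fin 5 → Fin 5 → Set
    Edge i j = if does (consecutive? (toℕ i) (toℕ j)) then A else ¬ A
      where A = Adj G (lookup ps i) (lookup ps j)

    edge : ∀ i j → Edge i j
    edge 0F 0F = Adj-irrefl
    edge 0F 1F = e₀₁
    edge 0F 2F = n₀₂
    edge 0F 3F = n₀₃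
    edge 0F 4F = n₀₄
    edge 1F 0F = Adj-sym e₀₁
    edge 1F 1F = Adj-irrefl
    edge 1F 2F = e₁₂
    edge 1F 3F = n₁₃
    edge 1F 4F = n₁₄
    edge 2F 0F = ≁-sym n₀₂
    edge 2F 1F = Adj-sym e₁₂
    edge 2F 2F = Adj-irrefl
    edge 2F 3F = e₂₃
    edge 2F 4F = n₂₄
    edge 3F 0F = ≁-sym n₀₃
    edge 3F 1F = ≁-sym n₁₃
    edge 3F 2F = Adj-sym e₂₃
    edge 3F 3F = Adj-irrefl
    edge 3F 4F = e₃₄
    edge 4F 0F = ≁-sym n₀₄
    edge 4F 1F = ≁-sym n₁₄
    edge 4F 2F = ≁-sym n₂₄
    edge 4F 3F = Adj-sym e₃₄
    edge 4F 4F = Adj-irrefl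

  _≟ˢ_ : ∀ (D D' : Subset n) → Dec (D ≡ D')
  _≟ˢ_ = ≡-dec Bool._≟_

  IsMinimalCover : Subset n → Subset n → List (Subset n) → Set
  IsMinimalCover X Z 𝓘 =
    IsComponentCollection G X 𝓘 × CoversAnticomplete G X Z 𝓘 ×
    (∀ 𝓘' → IsComponentCollection G X 𝓘' → (∀ D → D LM.∈ 𝓘' → D LM.∈ 𝓘) →
       CoversAnticomplete G X Z 𝓘' → ∀ D → D LM.∈ 𝓘 → D LM.∈ 𝓘')

  IsMissedByDominator : Subset n → Subset n → Subset n → Set
  IsMissedByDominator X Z D =
    IsComponent G X D ×
    ∃ λ z → z ∈ Z × (∀ D' → IsComponent G X D' → HasNbrIn G z D') × HasNonNbrIn G z D

  -- Otherwise 𝓘 without D would still have the covering property.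
  minimal-cover⇒private-vertex : ∀ {X Z 𝓘} → IsMinimalCover X Z 𝓘 → ∀ {D} → D LM.∈ 𝓘 →
    ∃ λ z → z ∈ Z × Anticomplete G z D × (∀ {D'} → D' LM.∈ 𝓘 → D' ≢ D → HasNbrIn G z D')
  minimal-cover⇒private-vertex {X} {Z} {𝓘} (collection , covers , minimal) {D} D∈𝓘 =
    conclude (any? private?)
    where
    ≢D? : ∀ D' → Dec (D' ≢ D)
    ≢D? D' = ¬? (D' ≟ˢ D)

    𝓘-D : List (Subset n)
    𝓘-D = filter ≢D? 𝓘

    Private : Fin n → Set
    Private z = z ∈ Z × Anticomplete G z D × All (HasNbrIn G z) 𝓘-D

    private? : ∀ z → Dec (Private z)
    private? z = z ∈? Z ×-dec anticomplete? z D ×-dec All.all? (hasNbrIn? z) 𝓘-D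

    collection-D : IsComponentCollection G X 𝓘-D
    collection-D = Unique.filter⁺ ≢D? (proj₁ collection) , All.filter⁺ ≢D? (proj₂ collection)

    covers-D : ¬ ∃ Private → CoversAnticomplete G X Z 𝓘-D
    covers-D none z z∈Z anti-some with covers z z∈Z anti-some
    ... | D' , D'∈𝓘 , z-anti-D' with D' ≟ˢ D
    ...   | no D'≢D = D' , ∈-filter⁺ ≢D? D'∈𝓘 D'≢D , z-anti-D'
    ...   | yes refl with All.all? (hasNbrIn? z) 𝓘-D
    ...     | yes z-sees  = contradiction (z , z∈Z , z-anti-D' , z-sees) none
    ...     | no ¬z-sees with LM.find (All.¬All⇒Any¬ (hasNbrIn? z) 𝓘-D ¬z-sees)
    ...       | D'' , D''∈𝓘-D , ¬nbr = D'' , D''∈𝓘-D , ¬HasNbrIn⇒Anticomplete ¬nbr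

    conclude : Dec (∃ Private) →
      ∃ λ z → z ∈ Z × Anticomplete G z D × (∀ {D'} → D' LM.∈ 𝓘 → D' ≢ D → HasNbrIn G z D')
    conclude (yes (z , z∈Z , z-anti , z-sees)) =
      z , z∈Z , z-anti , λ D'∈𝓘 D'≢D → All.lookup z-sees (∈-filter⁺ ≢D? D'∈𝓘 D'≢D)
    conclude (no none) =
      contradiction refl (proj₂ (∈-filter⁻ ≢D? {xs = 𝓘}
        (minimal 𝓘-D collection-D (λ _ → proj₁ ∘ ∈-filter⁻ ≢D?) (covers-D none) D D∈𝓘)))

  module _ (P5-free : P5Free G) {X : Subset n} where

    mixed-on-two-components⇒≡ : ∀ {z D D'} → IsComponent G X D → IsComponent G X D' →
      HasNbrIn G z D → HasNonNbrIn G z D → HasNbrIn G z D' → HasNonNbrIn G z D' → D ≡ D'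
    mixed-on-two-components⇒≡ {z} {D} {D'} D-comp@(_ , _ , walks , _) D'-comp@(_ , _ , walks' , _)
                              (b , b∈D , zb) (c , c∈D , z≁c) (b' , b'∈D' , zb') (c' , c'∈D' , z≁c')
      with D ≟ˢ D'
    ... | yes D≡D' = D≡D'
    ... | no D≢D'
      with walk-enters-neighbourhood z (walks c b c∈D b∈D) z≁c zb
         | walk-enters-neighbourhood z (walks' c' b' c'∈D' b'∈D') z≁c' zb'
    ... | a₁ , b₁ , a₁∈D , b₁∈D , a₁b₁ , z≁a₁ , zb₁ | a₂ , b₂ , a₂∈D' , b₂∈D' , a₂b₂ , z≁a₂ , zb₂ =
      ⊥-elim (P5-free _ refl (induced-P5 a₁ b₁ z b₂ a₂ a₁b₁ (Adj-sym zb₁) zb₂ (Adj-sym a₂b₂)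
        (≁-sym z≁a₁) (apart a₁∈D b₂∈D') (apart a₁∈D a₂∈D') (apart b₁∈D b₂∈D')
        (apart b₁∈D a₂∈D') z≁a₂))
      where
      apart : ∀ {u w} → u ∈ D → w ∈ D' → ¬ Adj G u w
      apart = distinct-components-anticomplete D-comp D'-comp D≢D'

    dominator-misses-one-component : ∀ {z D D' a} →
      (∀ D'' → IsComponent G X D'' → HasNbrIn G z D'') → IsComponent G X D → IsComponent G X D' →
      D ≢ D' → HasNonNbrIn G z D → a ∈ D' → Adj G z a
    dominator-misses-one-component {z} {D} {D'} {a} sees-all D-comp D'-comp D≢D' misses a∈D'
      with adj? z a
    ... | yes za  = za
    ... | no z≁a = contradiction (mixed-on-two-components⇒≡ D-comp D'-comp
                     (sees-all D D-comp) misses (sees-all D' D'-comp) (a , a∈D' , z≁a)) D≢D'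

    module _ {Z : Subset n} (cradle : IsCradle G X Z) where

      outside-N[X]⇒nonadjacent : ∀ {a m} → a ∈ X → ¬ InNClosed G X m → ¬ Adj G a m
      outside-N[X]⇒nonadjacent a∈X m∉ am = m∉ (inj₂ (m∉ ∘ inj₁ , _ , a∈X , am))

      attached⇒∈N[X] : ∀ {z a} → z ∈ Z → a ∈ X → Adj G z a → InN G X z
      attached⇒∈N[X] z∈Z a∈X za = (λ z∈X → proj₁ cradle _ z∈X z∈Z) , _ , a∈X , Adj-sym za

      ¬¬adjacent-past-outside-pair : ∀ {x z m m' w rest} → x ∈ X → Adj G x z →
        IsInducedPath G (z ∷ m ∷ m' ∷ w ∷ rest) → ¬ InNClosed G X m → ¬ InNClosed G X m' →
        ¬ ¬ Adj G x w
      ¬¬adjacent-past-outside-pair {x} {z} {m} {m'} {w} x∈X xz path m∉ m'∉ x≁w =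
        P5-free _ refl (induced-P5 x z m m' w xz
          (adjacent-on-path path 0F 1F) (adjacent-on-path path 1F 2F) (adjacent-on-path path 2F 3F)
          (outside-N[X]⇒nonadjacent x∈X m∉) (outside-N[X]⇒nonadjacent x∈X m'∉) x≁w
          (nonadjacent-on-path path 0F 2F) (nonadjacent-on-path path 0F 3F)
          (nonadjacent-on-path path 1F 3F))

      crossed-attachments⇒adjacent : ∀ {z z' a a'} → z ∈ Z → z' ∈ Z → a ∈ X → a' ∈ X →
        ¬ Adj G a a' → Adj G z a' → ¬ Adj G z a → Adj G z' a → ¬ Adj G z' a' → Adj G z z'
      crossed-attachments⇒adjacent {z} {z'} {a} {a'} z∈Z z'∈Z a∈X a'∈X a≁a' za' z≁a z'a z'≁a'
        with proj₂ cradle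
      ... | inj₁ ∣X∣≤1 =
        contradiction ∣X∣≤1 (<⇒≱ (two-members⇒2≤∣p∣ (λ { refl → z≁a za' }) a∈X a'∈X))
      ... | inj₂ (_ , connected)
        with connected z z' z∈Z (attached⇒∈N[X] z∈Z a'∈X za') z'∈Z (attached⇒∈N[X] z'∈Z a∈X z'a)
      ... | inj₁ refl = contradiction za' z'≁a'
      ... | inj₂ ([] , path , _) = adjacent-on-path path 0F 1F
      ... | inj₂ (m ∷ [] , path , m∉ ∷ []) =
        ⊥-elim (P5-free _ refl (induced-P5 a' z m z' a
          (Adj-sym za') (adjacent-on-path path 0F 1F) (adjacent-on-path path 1F 2F) z'a
          (outside-N[X]⇒nonadjacent a'∈X m∉) (≁-sym z'≁a') (≁-sym a≁a')
          (nonadjacent-on-path path 0F 2F) z≁a (≁-sym (outside-N[X]⇒nonadjacent a∈X m∉))))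
      ... | inj₂ (m ∷ m' ∷ [] , path , m∉ ∷ m'∉ ∷ []) =
        ⊥-elim (¬¬adjacent-past-outside-pair a'∈X (Adj-sym za') path m∉ m'∉ (≁-sym z'≁a'))
      ... | inj₂ (m ∷ m' ∷ m'' ∷ _ , path , m∉ ∷ m'∉ ∷ m''∉ ∷ _) =
        ⊥-elim (¬¬adjacent-past-outside-pair a'∈X (Adj-sym za') path m∉ m'∉
                  (outside-N[X]⇒nonadjacent a'∈X m''∉))

      module _ {ω : ℕ} (clique-number : IsCliqueNumber G ω) where

        minimal-cover-length≤ω : ∀ {𝓘} → IsMinimalCover X Z 𝓘 → length 𝓘 ≤ ω
        minimal-cover-length≤ω {𝓘} minimal-cover@((unique , components) , _) =
          adjacent-representatives⇒length≤ω clique-number private-vertex adjacent unique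
            (All.tabulate (λ D∈𝓘 → D∈𝓘))
          where
          private-vertex : ∀ {D} → D LM.∈ 𝓘 → Fin n
          private-vertex D∈𝓘 = proj₁ (minimal-cover⇒private-vertex minimal-cover D∈𝓘)

          adjacent : ∀ {D D'} (D∈𝓘 : D LM.∈ 𝓘) (D'∈𝓘 : D' LM.∈ 𝓘) → D ≢ D' →
                     Adj G (private-vertex D∈𝓘) (private-vertex D'∈𝓘)
          adjacent {D} {D'} D∈𝓘 D'∈𝓘 D≢D'
            with minimal-cover⇒private-vertex minimal-cover D∈𝓘
               | minimal-cover⇒private-vertex minimal-cover D'∈𝓘
          ... | z , z∈Z , z-anti , z-sees | z' , z'∈Z , z'-anti , z'-sees
            with z-sees D'∈𝓘 (D≢D' ∘ sym) | z'-sees D∈𝓘 D≢D'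
          ... | a' , a'∈D' , za' | a , a∈D , z'a =
            crossed-attachments⇒adjacent z∈Z z'∈Z (proj₁ D-comp a∈D) (proj₁ D'-comp a'∈D')
              (distinct-components-anticomplete D-comp D'-comp D≢D' a∈D a'∈D')
              za' (z-anti a a∈D) z'a (z'-anti a' a'∈D')
            where
            D-comp : IsComponent G X D
            D-comp = All.lookup components D∈𝓘
            D'-comp : IsComponent G X D'
            D'-comp = All.lookup components D'∈𝓘

        missed-by-dominators-length≤ω : ∀ {𝓙} → Unique 𝓙 → All (IsMissedByDominator X Z) 𝓙 →
                                        length 𝓙 ≤ ω
        missed-by-dominators-length≤ω =
          adjacent-representatives⇒length≤ω clique-number dominator adjacent
          where
          dominator : ∀ {D} → IsMissedByDominator X Z D → Fin n
          dominator = proj₁ ∘ proj₂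

          adjacent : ∀ {D D'} (p : IsMissedByDominator X Z D) (p' : IsMissedByDominator X Z D') →
                     D ≢ D' → Adj G (dominator p) (dominator p')
          adjacent (D-comp , z , z∈Z , z-sees , z-misses@(a , a∈D , z≁a))
                   (D'-comp , z' , z'∈Z , z'-sees , z'-misses@(a' , a'∈D' , z'≁a')) D≢D' =
            crossed-attachments⇒adjacent z∈Z z'∈Z (proj₁ D-comp a∈D) (proj₁ D'-comp a'∈D')
              (distinct-components-anticomplete D-comp D'-comp D≢D' a∈D a'∈D')
              (dominator-misses-one-component z-sees D-comp D'-comp D≢D' z-misses a'∈D') z≁a
              (dominator-misses-one-component z'-sees D'-comp D-comp (D≢D' ∘ sym) z'-misses a∈D)
              z'≁a'

lemma3p2 : ∀ {n : ℕ} (G : Graph n) → P5Free G →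
    ∀ (X Z : Subset n) → IsCradle G X Z →
    ∀ (𝓘 𝓙 : List (Subset n)) → IsRocker G X Z 𝓘 𝓙 →
    ∀ (ω : ℕ) → IsCliqueNumber G ω →
    length 𝓘 ≤ ω × length 𝓙 ≤ ω
lemma3p2 G P5-free X Z cradle 𝓘 𝓙
         (𝓘-collection , covers , minimal , (𝓙-unique , _) , 𝓙-spec) ω clique-number =
  minimal-cover-length≤ω G P5-free cradle clique-number (𝓘-collection , covers , minimal) ,
  missed-by-dominators-length≤ω G P5-free cradle clique-number 𝓙-unique
    (All.tabulate (Equivalence.to (𝓙-spec _)))
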